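{- Let $r\ge 2$, $n\ge 1$, and fix colors $0\le c<d\le r-1$. Let $A_{r,n}(q)=\sum_{\pi\in G_{r,n}}q^{\mathrm{des}_{c,d}(\pi)}$. Then $$A_{r,n}(q)=n!\sum_{\mu\in\mathrm{Comp^{clr}}(n)}(q+r-2)^{t_\mu}(r-1)^{n-k_\mu-t_\mu}.$$
   Context: $G_{r,n}$ is the set of words $\pi=\pi_1^{[c_1]}\cdots\pi_n^{[c_n]}$ with $\pi_1\cdots\pi_n$ a permutation of $\{1,\dots,n\}$ and colors $c_i\in\{0,\dots,r-1\}$, with order $a^{[i]}<b^{[j]}$ iff $i>j$, or $i=j$ and $a<b$. $\mathrm{des}_{c,d}(\pi)$ is the number of $i\in\{1,\dots,n-1\}$ with $\pi_i^{[c_i]}>\pi_{i+1}^{[c_{i+1}]}$, $c_i=c$, $c_{i+1}=d$. $\mathrm{Comp}(n)$ is the set of compositions $\varphi=(\varphi_1,\dots,\varphi_\ell)$ of $n$ into positive parts, and $\mathrm{Comp^{clr}}(n)=\mathrm{Comp}(n)\times\{c,\bar c\}$, where $\bar c$ is a formal symbol meaning "a color different from $c$". For $\mu=(\varphi,x)$, the parts of $\varphi$ are labeled alternately $x$, then the other symbol, then $x$, etc. (so part $1$ gets label $x$). $k_\mu$ is the sum of the parts labeled $c$ (equivalently, $k_\mu=n-e_\varphi$ if $x=c$ and $k_\mu=e_\varphi$ if $x=\bar c$, where $e_\varphi$ is the sum of the parts in even positions of $\varphi$), and $t_\mu$ is the number of indices $i<\ell$ such that part $i$ is labeled $c$ (the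 number of transitions from a $c$-labeled part to a $\bar c$-labeled part). -}

module Defs where

open import Data.Nat using (ℕ; zero; suc; _+_; _*_; _∸_; _^_; _<ᵇ_; _≡ᵇ_)
open import Data.Bool using (Bool; true; false; _∧_; _∨_; if_then_else_)
open import Data.List using (List; []; _∷_; map; concatMap; upTo; _++_; zip)
open import Data.Nat.ListAction using (sum)
open import Data.Product using (_×_; _,_)

-- A coloured letter a^[i] is the pair (a , i).
Letter : Set
Letter = ℕ × ℕ

_<ᶜ_ : Letter → Letter → Bool
(a , i) <ᶜ (b , j) = (j <ᵇ i) ∨ ((i ≡ᵇ j) ∧ (a <ᵇ b))

insertions : ℕ → List ℕ → List (List ℕ)
insertions x []       = (x ∷ []) ∷ []
insertions x (y ∷ ys) = (x ∷ y ∷ ys) ∷ map (y ∷_) (insertions x ys)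

perms : List ℕ → List (List ℕ)
perms []       = [] ∷ []
perms (x ∷ xs) = concatMap (insertions x) (perms xs)

colourings : ℕ → ℕ → List (List ℕ)
colourings r zero    = [] ∷ []
colourings r (suc n) = concatMap (λ c → map (c ∷_) (colourings r n)) (upTo r)

G : ℕ → ℕ → List (List Letter)
G r n = concatMap (λ p → map (zip p) (colourings r n)) (perms (map suc (upTo n)))

des : ℕ → ℕ → List Letter → ℕ
des c d []                = 0
des c d (x ∷ [])          = 0
des c d ((a , i) ∷ (b , j) ∷ w) =
  (if ((b , j) <ᶜ (a , i)) ∧ (i ≡ᵇ c) ∧ (j ≡ᵇ d) then 1 else 0)
  + des c d ((b , j) ∷ w)

A : ℕ → ℕ → ℕ → ℕ → ℕ → ℕ
A c d r n q = sum (map (λ w → q ^ des c d w) (G r n))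

-- For n ≥ 1 every composition
-- of n+1 arises uniquely from a composition of n either by adding 1 to the first
-- part or by prepending a new part 1.
incrHead : List ℕ → List ℕ
incrHead []       = []
incrHead (x ∷ xs) = suc x ∷ xs

Comp : ℕ → List (List ℕ)
Comp zero          = [] ∷ []
Comp (suc zero)    = (1 ∷ []) ∷ []
Comp (suc (suc m)) = map incrHead (Comp (suc m)) ++ map (1 ∷_) (Comp (suc m))

-- Comp^clr(n) = Comp(n) × {c, c̄};  the Bool is true for c, false for c̄.
CompClr : ℕ → List (List ℕ × Bool)
CompClr n = concatMap (λ φ → (φ , true) ∷ (φ , false) ∷ []) (Comp n)

-- sum of the parts labelled c, labels alternating starting with the given one
kLab : Bool → List ℕ → ℕ
kLab b     []       = 0
kLab true  (p ∷ ps) = p + kLab false ps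
kLab false (p ∷ ps) = kLab true ps

-- number of indices i < ℓ whose part is labelled c
tLab : Bool → List ℕ → ℕ
tLab b     []           = 0
tLab b     (p ∷ [])     = 0
tLab true  (p ∷ q ∷ ps) = suc (tLab false (q ∷ ps))
tLab false (p ∷ q ∷ ps) = tLab true (q ∷ ps)

k : List ℕ × Bool → ℕ
k (φ , x) = kLab x φ

t : List ℕ × Bool → ℕ
t (φ , x) = tLab x φ

-- Since c < d, a letter of colour c exceeds every letter of colour d, so des_{c,d}
-- counts the adjacent colour pairs (c, d) and does not see the permutation:
-- A_{r,n}(q) = n! · S n, where S n is the total q-weight of colour sequences of
-- length n.  Splitting off the first colour, S and the weight C n of sequences
-- c ∷ cs with cs of length n satisfy
--   S (n+1) = C n + (r-1) S n,    C (n+1) = C n + (q+r-2) S n.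
-- Comp (n+1) arises from Comp n by growing the first part or prepending a part 1.
-- Along this, the total weight of the c-labelled compositions and that of the
-- c̄-labelled ones (with the exponent of r-1 lowered by one) obey the same
-- recursion with the same initial values.

module Submission where

open import Defs
open import Data.Nat using (ℕ; _+_; _*_; _∸_; _^_; _≤_; _<_)
open import Data.Nat using (_!)
open import Data.List using (map)
open import Data.Nat.ListAction using (sum)
open import Relation.Binary.PropositionalEquality using (_≡_)

import Algebra.Properties.CommutativeSemigroup as CommSemigroupProperties
open import Data.Bool using (Bool; true; false; _∧_; if_then_else_)
open import Data.Bool.Properties using (∧-zeroʳ; T-≡)
open import Data.Empty using (⊥; ⊥-elim)
open import Data.List using (List; []; _∷_; _++_; concatMap; applyUpTo; upTo; zip; length)
open import Data.List.Properties
  using (map-++; map-∘; map-cong; map-cong-local; map-upTo; length-map; length-upTo; length-++)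
open import Data.List.Relation.Unary.All as All using (All; []; _∷_)
open import Data.List.Relation.Unary.All.Properties using (++⁺; map⁺; concat⁺; applyUpTo⁺₂)
open import Data.Nat using (zero; suc; z≤n; s≤s; _≡ᵇ_; _<ᵇ_)
open import Data.Nat.ListAction.Properties using (sum-++)
open import Data.Nat.Properties
open import Data.Nat.Tactic.RingSolver using (solve-∀)
open import Data.Product using (_×_; _,_)
open import Function using (_∘_)
open import Function.Bundles using (Equivalence)
open import Relation.Binary.PropositionalEquality
  using (refl; sym; trans; cong; cong₂; subst₂; _≢_; module ≡-Reasoning)
open ≡-Reasoning

module +-Props = CommSemigroupProperties +-commutativeSemigroup
module *-Props = CommSemigroupProperties *-commutativeSemigroup

sum-map-concatMap : ∀ {A B : Set} (g : B → ℕ) (f : A → List B) (xs : List A) →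
  sum (map g (concatMap f xs)) ≡ sum (map (sum ∘ map g ∘ f) xs)
sum-map-concatMap g f []       = refl
sum-map-concatMap g f (x ∷ xs) = begin
  sum (map g (f x ++ concatMap f xs))                ≡⟨ cong sum (map-++ g (f x) _) ⟩
  sum (map g (f x) ++ map g (concatMap f xs))        ≡⟨ sum-++ (map g (f x)) _ ⟩
  sum (map g (f x)) + sum (map g (concatMap f xs))   ≡⟨ cong (_ +_) (sum-map-concatMap g f xs) ⟩
  sum (map g (f x)) + sum (map (sum ∘ map g ∘ f) xs) ∎

sum-map-+ : ∀ {A : Set} (f g : A → ℕ) (xs : List A) →
  sum (map (λ x → f x + g x) xs) ≡ sum (map f xs) + sum (map g xs)
sum-map-+ f g []       = refl
sum-map-+ f g (x ∷ xs) =
  trans (cong (f x + g x +_) (sum-map-+ f g xs)) (+-Props.interchange (f x) (g x) _ _)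

sum-map-*ˡ : ∀ {A : Set} (m : ℕ) (f : A → ℕ) (xs : List A) →
  sum (map (λ x → m * f x) xs) ≡ m * sum (map f xs)
sum-map-*ˡ m f []       = sym (*-zeroʳ m)
sum-map-*ˡ m f (x ∷ xs) =
  trans (cong (m * f x +_) (sum-map-*ˡ m f xs)) (sym (*-distribˡ-+ m (f x) _))

sum-map-const : ∀ {A : Set} (K : ℕ) (xs : List A) → sum (map (λ _ → K) xs) ≡ length xs * K
sum-map-const K []       = refl
sum-map-const K (x ∷ xs) = cong (K +_) (sum-map-const K xs)

length-concatMap-const : ∀ {A B : Set} (f : A → List B) {m} {xs : List A} →
  All (λ x → length (f x) ≡ m) xs → length (concatMap f xs) ≡ length xs * m
length-concatMap-const f []                     = refl
length-concatMap-const f {xs = x ∷ _} (fx ∷ fxs) =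
  trans (length-++ (f x)) (cong₂ _+_ fx (length-concatMap-const f fxs))

applyUpTo-cong : ∀ {f g : ℕ → ℕ} → (∀ j → f j ≡ g j) → ∀ n → applyUpTo f n ≡ applyUpTo g n
applyUpTo-cong f≡g zero    = refl
applyUpTo-cong f≡g (suc n) = cong₂ _∷_ (f≡g 0) (applyUpTo-cong (f≡g ∘ suc) n)

sum-applyUpTo-const : ∀ (K n : ℕ) → sum (applyUpTo (λ _ → K) n) ≡ n * K
sum-applyUpTo-const K zero    = refl
sum-applyUpTo-const K (suc n) = cong (K +_) (sum-applyUpTo-const K n)

sum-applyUpTo-update : ∀ (f g : ℕ → ℕ) {i n} → i < n → (∀ j → j ≢ i → f j ≡ g j) →
  sum (applyUpTo f n) + g i ≡ f i + sum (applyUpTo g n)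
sum-applyUpTo-update f g {zero} {suc n} _ f≡g = begin
  f 0 + sum (applyUpTo (f ∘ suc) n) + g 0   ≡⟨ +-assoc (f 0) _ (g 0) ⟩
  f 0 + (sum (applyUpTo (f ∘ suc) n) + g 0) ≡⟨ cong (λ s → f 0 + (sum s + g 0)) rest ⟩
  f 0 + (sum (applyUpTo (g ∘ suc) n) + g 0) ≡⟨ cong (f 0 +_) (+-comm _ (g 0)) ⟩
  f 0 + sum (applyUpTo g (suc n))           ∎
  where
  rest : applyUpTo (f ∘ suc) n ≡ applyUpTo (g ∘ suc) n
  rest = applyUpTo-cong (λ j → f≡g (suc j) λ ()) n
sum-applyUpTo-update f g {suc i} {suc n} (s≤s i<n) f≡g = begin
  f 0 + sum (applyUpTo (f ∘ suc) n) + g (suc i)   ≡⟨ +-assoc (f 0) _ _ ⟩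
  f 0 + (sum (applyUpTo (f ∘ suc) n) + g (suc i)) ≡⟨ cong (f 0 +_) shifted ⟩
  f 0 + (f (suc i) + sum (applyUpTo (g ∘ suc) n)) ≡⟨ +-Props.x∙yz≈y∙xz (f 0) (f (suc i)) _ ⟩
  f (suc i) + (f 0 + sum (applyUpTo (g ∘ suc) n)) ≡⟨ cong (λ y → f (suc i) + (y + _)) (f≡g 0 λ ()) ⟩
  f (suc i) + sum (applyUpTo g (suc n))           ∎
  where
  shifted : sum (applyUpTo (f ∘ suc) n) + g (suc i) ≡ f (suc i) + sum (applyUpTo (g ∘ suc) n)
  shifted = sum-applyUpTo-update (f ∘ suc) (g ∘ suc) i<n (λ j j≢i → f≡g (suc j) (j≢i ∘ suc-injective))

≡ᵇ-refl : ∀ n → (n ≡ᵇ n) ≡ true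
≡ᵇ-refl n = Equivalence.to T-≡ (≡⇒≡ᵇ n n refl)

≡ᵇ-true : ∀ {m n} → (m ≡ᵇ n) ≡ true → m ≡ n
≡ᵇ-true {m} {n} eq = ≡ᵇ⇒≡ m n (Equivalence.from T-≡ eq)

<ᵇ-true : ∀ {m n} → m < n → (m <ᵇ n) ≡ true
<ᵇ-true {m} {n} m<n = Equivalence.to (T-≡ {m <ᵇ n}) (<⇒<ᵇ m<n)

≢⇒≡ᵇ-false : ∀ {m n} → m ≢ n → (m ≡ᵇ n) ≡ false
≢⇒≡ᵇ-false {m} {n} m≢n with m ≡ᵇ n in eq
... | true  = ⊥-elim (m≢n (≡ᵇ-true eq))
... | false = refl

suc-∸-∸ : ∀ n x y → x + y ≤ n → suc n ∸ x ∸ y ≡ suc (n ∸ x ∸ y)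
suc-∸-∸ n x y x+y≤n = begin
  suc n ∸ x ∸ y     ≡⟨ ∸-+-assoc (suc n) x y ⟩
  suc n ∸ (x + y)   ≡⟨ +-∸-assoc 1 x+y≤n ⟩
  suc (n ∸ (x + y)) ≡⟨ cong suc (∸-+-assoc n x y) ⟨
  suc (n ∸ x ∸ y)   ∎

All-length-insertions : ∀ x ys → All (λ p → length p ≡ suc (length ys)) (insertions x ys)
All-length-insertions x []       = refl ∷ []
All-length-insertions x (y ∷ ys) = refl ∷ map⁺ (All.map (cong suc) (All-length-insertions x ys))

length-insertions : ∀ x ys → length (insertions x ys) ≡ suc (length ys)
length-insertions x []       = refl
length-insertions x (y ∷ ys) =
  cong suc (trans (length-map (y ∷_) (insertions x ys)) (length-insertions x ys))

All-length-perms : ∀ xs → All (λ p → length p ≡ length xs) (perms xs)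
All-length-perms []       = refl ∷ []
All-length-perms (x ∷ xs) = concat⁺ (map⁺ (All.map insert (All-length-perms xs)))
  where
  insert : ∀ {p} → length p ≡ length xs → All (λ p′ → length p′ ≡ suc (length xs)) (insertions x p)
  insert ∣p∣ = All.map (λ ∣p′∣ → trans ∣p′∣ (cong suc ∣p∣)) (All-length-insertions x _)

length-perms : ∀ xs → length (perms xs) ≡ length xs !
length-perms []       = refl
length-perms (x ∷ xs) = begin
  length (concatMap (insertions x) (perms xs)) ≡⟨ length-concatMap-const (insertions x) ∣insertions∣ ⟩
  length (perms xs) * suc (length xs)          ≡⟨ cong (_* suc (length xs)) (length-perms xs) ⟩
  length xs ! * suc (length xs)                ≡⟨ *-comm (length xs !) _ ⟩
  suc (length xs) !                            ∎
  where
  ∣insertions∣ : All (λ p → length (insertions x p) ≡ suc (length xs)) (perms xs)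
  ∣insertions∣ = All.map (λ {p} ∣p∣ → trans (length-insertions x p) (cong suc ∣p∣)) (All-length-perms xs)

All-length-colourings : ∀ r n → All (λ cs → length cs ≡ n) (colourings r n)
All-length-colourings r zero    = refl ∷ []
All-length-colourings r (suc n) =
  concat⁺ (map⁺ (applyUpTo⁺₂ _ r λ _ → map⁺ (All.map (cong suc) (All-length-colourings r n))))

sum-colourings-suc : ∀ r n (h : List ℕ → ℕ) →
  sum (map h (colourings r (suc n))) ≡ sum (applyUpTo (λ j → sum (map (h ∘ (j ∷_)) (colourings r n))) r)
sum-colourings-suc r n h = begin
  sum (map h (colourings r (suc n)))
    ≡⟨ sum-map-concatMap h (λ j → map (j ∷_) (colourings r n)) (upTo r) ⟩
  sum (map (λ j → sum (map h (map (j ∷_) (colourings r n)))) (upTo r))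
    ≡⟨ cong sum (map-cong (λ j → cong sum (map-∘ (colourings r n))) (upTo r)) ⟨
  sum (map (λ j → sum (map (h ∘ (j ∷_)) (colourings r n))) (upTo r))
    ≡⟨ cong sum (map-upTo _ r) ⟩
  sum (applyUpTo (λ j → sum (map (h ∘ (j ∷_)) (colourings r n))) r) ∎

desᶜ : ℕ → ℕ → List ℕ → ℕ
desᶜ c d []          = 0
desᶜ c d (_ ∷ [])    = 0
desᶜ c d (i ∷ j ∷ w) = (if (i ≡ᵇ c) ∧ (j ≡ᵇ d) then 1 else 0) + desᶜ c d (j ∷ w)

cd-pair-descends : ∀ {c d} → c < d → ∀ a i b j →
  ((b , j) <ᶜ (a , i)) ∧ (i ≡ᵇ c) ∧ (j ≡ᵇ d) ≡ (i ≡ᵇ c) ∧ (j ≡ᵇ d)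
cd-pair-descends {c} {d} c<d a i b j with i ≡ᵇ c in i≡c | j ≡ᵇ d in j≡d
... | false | _     = ∧-zeroʳ _
... | true  | false = ∧-zeroʳ _
... | true  | true
  rewrite <ᵇ-true (subst₂ _<_ (sym (≡ᵇ-true {i} i≡c)) (sym (≡ᵇ-true {j} j≡d)) c<d) = refl

des-zip : ∀ {c d} → c < d → ∀ (p cs : List ℕ) → length p ≡ length cs →
  des c d (zip p cs) ≡ desᶜ c d cs
des-zip c<d []          []          _ = refl
des-zip c<d (_ ∷ [])    (_ ∷ [])    _ = refl
des-zip c<d (a ∷ b ∷ p) (i ∷ j ∷ cs) ∣p∣≡∣cs∣ =
  cong₂ _+_ (cong (if_then 1 else 0) (cd-pair-descends c<d a i b j))
            (des-zip c<d (b ∷ p) (j ∷ cs) (suc-injective ∣p∣≡∣cs∣))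

desᶜ-∷-≢ : ∀ {c d i} → i ≢ c → ∀ cs → desᶜ c d (i ∷ cs) ≡ desᶜ c d cs
desᶜ-∷-≢ i≢c []      = refl
desᶜ-∷-≢ i≢c (j ∷ _) rewrite ≢⇒≡ᵇ-false i≢c = refl

desᶜ-∷-∷-≢ : ∀ {c d} i {j} → j ≢ d → ∀ cs → desᶜ c d (i ∷ j ∷ cs) ≡ desᶜ c d (j ∷ cs)
desᶜ-∷-∷-≢ {c} i j≢d cs rewrite ≢⇒≡ᵇ-false j≢d | ∧-zeroʳ (i ≡ᵇ c) = refl

desᶜ-cd : ∀ c d cs → desᶜ c d (c ∷ d ∷ cs) ≡ suc (desᶜ c d (d ∷ cs))
desᶜ-cd c d cs rewrite ≡ᵇ-refl c | ≡ᵇ-refl d = refl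

module Colours (c d r q : ℕ) where

  weight : List ℕ → ℕ
  weight cs = q ^ desᶜ c d cs

  total : ℕ → ℕ
  total n = sum (map weight (colourings r n))

  startingAt : ℕ → ℕ → ℕ
  startingAt j n = sum (map (weight ∘ (j ∷_)) (colourings r n))

  startingAt-≢ : ∀ {j} → j ≢ c → ∀ n → startingAt j n ≡ total n
  startingAt-≢ j≢c n = cong sum (map-cong (cong (q ^_) ∘ desᶜ-∷-≢ j≢c) (colourings r n))

  total-suc+total : c < r → ∀ n → total (suc n) + total n ≡ startingAt c n + r * total n
  total-suc+total c<r n = begin
    total (suc n) + total n
      ≡⟨ cong (_+ total n) (sum-colourings-suc r n weight) ⟩
    sum (applyUpTo (λ j → startingAt j n) r) + total n
      ≡⟨ sum-applyUpTo-update _ (λ _ → total n) c<r (λ _ j≢c → startingAt-≢ j≢c n) ⟩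
    startingAt c n + sum (applyUpTo (λ _ → total n) r)
      ≡⟨ cong (startingAt c n +_) (sum-applyUpTo-const (total n) r) ⟩
    startingAt c n + r * total n ∎

  startingAt-c-suc+total : c ≢ d → d < r → ∀ n →
    startingAt c (suc n) + total n ≡ q * total n + total (suc n)
  startingAt-c-suc+total c≢d d<r n = begin
    startingAt c (suc n) + total n
      ≡⟨ cong₂ _+_ (sum-colourings-suc r n (weight ∘ (c ∷_))) (sym (startingAt-≢ (c≢d ∘ sym) n)) ⟩
    sum (applyUpTo afterC r) + startingAt d n
      ≡⟨ sum-applyUpTo-update afterC (λ j → startingAt j n) d<r afterC-≢ ⟩
    afterC d + sum (applyUpTo (λ j → startingAt j n) r)
      ≡⟨ cong₂ _+_ afterC-d (sym (sum-colourings-suc r n weight)) ⟩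
    q * total n + total (suc n) ∎
    where
    afterC : ℕ → ℕ
    afterC j = sum (map (weight ∘ (c ∷_) ∘ (j ∷_)) (colourings r n))
    afterC-≢ : ∀ j → j ≢ d → afterC j ≡ startingAt j n
    afterC-≢ j j≢d = cong sum (map-cong (cong (q ^_) ∘ desᶜ-∷-∷-≢ c j≢d) (colourings r n))
    afterC-d : afterC d ≡ q * total n
    afterC-d = begin
      afterC d
        ≡⟨ cong sum (map-cong (cong (q ^_) ∘ desᶜ-cd c d) (colourings r n)) ⟩
      sum (map (λ cs → q * weight (d ∷ cs)) (colourings r n))
        ≡⟨ sum-map-*ˡ q (weight ∘ (d ∷_)) (colourings r n) ⟩
      q * startingAt d n
        ≡⟨ cong (q *_) (startingAt-≢ (c≢d ∘ sym) n) ⟩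
      q * total n ∎

A≡!*total : ∀ {c d} → c < d → ∀ r n q → A c d r n q ≡ n ! * Colours.total c d r q n
A≡!*total {c} {d} c<d r n q = begin
  A c d r n q
    ≡⟨ sum-map-concatMap (λ w → q ^ des c d w) (λ p → map (zip p) (colourings r n)) (perms ids) ⟩
  sum (map (λ p → sum (map (λ w → q ^ des c d w) (map (zip p) (colourings r n)))) (perms ids))
    ≡⟨ cong sum (map-cong-local (All.map (λ ∣p∣ → perTerm (trans ∣p∣ ∣ids∣)) (All-length-perms ids))) ⟩
  sum (map (λ _ → total n) (perms ids))
    ≡⟨ sum-map-const (total n) (perms ids) ⟩
  length (perms ids) * total n
    ≡⟨ cong (_* total n) (trans (length-perms ids) (cong _! ∣ids∣)) ⟩
  n ! * total n ∎
  where
  open Colours c d r q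
  ids : List ℕ
  ids = map suc (upTo n)
  ∣ids∣ : length ids ≡ n
  ∣ids∣ = trans (length-map suc (upTo n)) (length-upTo n)
  perTerm : ∀ {p} → length p ≡ n → sum (map (λ w → q ^ des c d w) (map (zip p) (colourings r n))) ≡ total n
  perTerm {p} ∣p∣ = cong sum (trans (sym (map-∘ (colourings r n)))
    (map-cong-local (All.map (λ ∣cs∣ → cong (q ^_) (des-zip c<d p _ (trans ∣p∣ (sym ∣cs∣))))
                             (All-length-colourings r n))))

sum-CompClr : ∀ (w : List ℕ × Bool → ℕ) n →
  sum (map w (CompClr n)) ≡ sum (map (λ φ → w (φ , true)) (Comp n)) + sum (map (λ φ → w (φ , false)) (Comp n))
sum-CompClr w n = begin
  sum (map w (CompClr n))
    ≡⟨ sum-map-concatMap w (λ φ → (φ , true) ∷ (φ , false) ∷ []) (Comp n) ⟩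
  sum (map (λ φ → w (φ , true) + (w (φ , false) + 0)) (Comp n))
    ≡⟨ cong sum (map-cong (λ φ → cong (w (φ , true) +_) (+-identityʳ _)) (Comp n)) ⟩
  sum (map (λ φ → w (φ , true) + w (φ , false)) (Comp n))
    ≡⟨ sum-map-+ (λ φ → w (φ , true)) (λ φ → w (φ , false)) (Comp n) ⟩
  sum (map (λ φ → w (φ , true)) (Comp n)) + sum (map (λ φ → w (φ , false)) (Comp n)) ∎

-- The bounds behind the truncated subtractions in the exponents; the pattern
-- match also records that compositions of a positive number are non-empty.
CompBounds : ℕ → List ℕ → Set
CompBounds m []       = ⊥
CompBounds m (p ∷ ps) = kLab true (p ∷ ps) + tLab true (p ∷ ps) ≤ suc m
                      × kLab false (p ∷ ps) + tLab false (p ∷ ps) ≤ m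

tLab-ignores-head : ∀ x p p′ ps → tLab x (p ∷ ps) ≡ tLab x (p′ ∷ ps)
tLab-ignores-head x     p p′ []      = refl
tLab-ignores-head true  p p′ (_ ∷ _) = refl
tLab-ignores-head false p p′ (_ ∷ _) = refl

CompBounds-incrHead : ∀ {m φ} → CompBounds m φ → CompBounds (suc m) (incrHead φ)
CompBounds-incrHead {m} {p ∷ ps} (c-bound , c̄-bound)
  rewrite tLab-ignores-head true (suc p) p ps | tLab-ignores-head false (suc p) p ps =
  s≤s c-bound , m≤n⇒m≤1+n c̄-bound

CompBounds-∷-one : ∀ {m φ} → CompBounds m φ → CompBounds (suc m) (1 ∷ φ)
CompBounds-∷-one {m} {p ∷ ps} (c-bound , c̄-bound) =
  s≤s (subst₂ _≤_ (sym (+-suc _ _)) refl (s≤s c̄-bound)) , c-bound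

Comp-bounds : ∀ m → All (CompBounds m) (Comp (suc m))
Comp-bounds zero    = (s≤s z≤n , z≤n) ∷ []
Comp-bounds (suc m) = ++⁺ (map⁺ (All.map CompBounds-incrHead (Comp-bounds m)))
                          (map⁺ (All.map CompBounds-∷-one (Comp-bounds m)))

sum-Comp-suc : ∀ m (h : List ℕ → ℕ) →
  sum (map h (Comp (suc (suc m)))) ≡
  sum (map (h ∘ incrHead) (Comp (suc m))) + sum (map (h ∘ (1 ∷_)) (Comp (suc m)))
sum-Comp-suc m h = begin
  sum (map h (map incrHead CC ++ map (1 ∷_) CC))
    ≡⟨ cong sum (map-++ h (map incrHead CC) (map (1 ∷_) CC)) ⟩
  sum (map h (map incrHead CC) ++ map h (map (1 ∷_) CC))
    ≡⟨ sum-++ (map h (map incrHead CC)) _ ⟩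
  sum (map h (map incrHead CC)) + sum (map h (map (1 ∷_) CC))
    ≡⟨ cong₂ _+_ (cong sum (map-∘ CC)) (cong sum (map-∘ CC)) ⟨
  sum (map (h ∘ incrHead) CC) + sum (map (h ∘ (1 ∷_)) CC) ∎
  where
  CC : List (List ℕ)
  CC = Comp (suc m)

sum-Comp-cong : ∀ m {f g : List ℕ → ℕ} → (∀ {φ} → CompBounds m φ → f φ ≡ g φ) →
  sum (map f (Comp (suc m))) ≡ sum (map g (Comp (suc m)))
sum-Comp-cong m f≡g = cong sum (map-cong-local (All.map f≡g (Comp-bounds m)))

module CompositionWeights (a b : ℕ) where

  weight : ℕ → Bool → List ℕ → ℕ
  weight n x φ = a ^ tLab x φ * b ^ (n ∸ kLab x φ ∸ tLab x φ)

  weight-incrHead-true : ∀ n p ps → weight (suc n) true (incrHead (p ∷ ps)) ≡ weight n true (p ∷ ps)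
  weight-incrHead-true n p ps rewrite tLab-ignores-head true (suc p) p ps = refl

  weight-incrHead-false : ∀ n p ps → weight n false (incrHead (p ∷ ps)) ≡ weight n false (p ∷ ps)
  weight-incrHead-false n p ps rewrite tLab-ignores-head false (suc p) p ps = refl

  weight-∷-false : ∀ n p φ → weight n false (p ∷ φ) ≡ weight n true φ
  weight-∷-false n p []      = refl
  weight-∷-false n p (_ ∷ _) = refl

  weight-∷-one-true : ∀ {m φ} → CompBounds m φ → weight (suc (suc m)) true (1 ∷ φ) ≡ a * weight m false φ
  weight-∷-one-true {m} {p ∷ ps} (_ , c̄-bound)
    rewrite +-∸-assoc 1 (≤-trans (m≤m+n (kLab false (p ∷ ps)) _) c̄-bound) = *-assoc a _ _

  weight-suc-false : ∀ {m φ} → CompBounds m φ → weight (suc m) false φ ≡ b * weight m false φ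
  weight-suc-false {m} {p ∷ ps} (_ , c̄-bound)
    rewrite suc-∸-∸ m (kLab false (p ∷ ps)) (tLab false (p ∷ ps)) c̄-bound =
    *-Props.x∙yz≈y∙xz (a ^ tLab false (p ∷ ps)) b _

  Wc Wc̄ : ℕ → ℕ
  Wc m = sum (map (weight (suc m) true) (Comp (suc m)))
  Wc̄ m = sum (map (weight (suc m) false) (Comp (suc m)))

  -- Wc̄ with every exponent of b lowered by one; this, not Wc̄, is what matches
  -- the colour-sequence weight S.
  Wc̄⁻ : ℕ → ℕ
  Wc̄⁻ m = sum (map (weight m false) (Comp (suc m)))

  Wc̄≡b*Wc̄⁻ : ∀ m → Wc̄ m ≡ b * Wc̄⁻ m
  Wc̄≡b*Wc̄⁻ m = trans (sum-Comp-cong m weight-suc-false) (sum-map-*ˡ b (weight m false) (Comp (suc m)))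

  Wc-suc : ∀ m → Wc (suc m) ≡ Wc m + a * Wc̄⁻ m
  Wc-suc m = begin
    Wc (suc m)
      ≡⟨ sum-Comp-suc m (weight (suc (suc m)) true) ⟩
    sum (map (weight (suc (suc m)) true ∘ incrHead) CC) + sum (map (weight (suc (suc m)) true ∘ (1 ∷_)) CC)
      ≡⟨ cong₂ _+_ (sum-Comp-cong m λ { {p ∷ ps} _ → weight-incrHead-true (suc m) p ps })
                   (sum-Comp-cong m weight-∷-one-true) ⟩
    Wc m + sum (map (λ φ → a * weight m false φ) CC)
      ≡⟨ cong (Wc m +_) (sum-map-*ˡ a (weight m false) CC) ⟩
    Wc m + a * Wc̄⁻ m ∎
    where
    CC : List (List ℕ)
    CC = Comp (suc m)

  Wc̄⁻-suc : ∀ m → Wc̄⁻ (suc m) ≡ Wc̄ m + Wc m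
  Wc̄⁻-suc m = trans (sum-Comp-suc m (weight (suc m) false))
    (cong₂ _+_ (sum-Comp-cong m λ { {p ∷ ps} _ → weight-incrHead-false (suc m) p ps })
               (cong sum (map-cong (weight-∷-false (suc m) 1) (Comp (suc m)))))

module ColoursVsCompositions (c d r₀ q : ℕ) (c<d : c < d) (d<r : d < 2 + r₀) where
  open Colours c d (2 + r₀) q
  open CompositionWeights (q + r₀) (suc r₀) using (Wc; Wc̄; Wc̄⁻; Wc̄≡b*Wc̄⁻; Wc-suc; Wc̄⁻-suc)

  total-suc : ∀ m → total (suc m) ≡ startingAt c m + suc r₀ * total m
  total-suc m = +-cancelʳ-≡ (total m) _ _ (begin
    total (suc m) + total m                       ≡⟨ total-suc+total (<-trans c<d d<r) m ⟩
    startingAt c m + (total m + suc r₀ * total m) ≡⟨ cong (startingAt c m +_) (+-comm (total m) _) ⟩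
    startingAt c m + (suc r₀ * total m + total m) ≡⟨ +-assoc (startingAt c m) _ (total m) ⟨
    startingAt c m + suc r₀ * total m + total m   ∎)

  startingAt-c-suc : ∀ m → startingAt c (suc m) ≡ startingAt c m + (q + r₀) * total m
  startingAt-c-suc m = +-cancelʳ-≡ (total m) _ _ (begin
    startingAt c (suc m) + total m                     ≡⟨ startingAt-c-suc+total (<⇒≢ c<d) d<r m ⟩
    q * total m + total (suc m)                        ≡⟨ cong (q * total m +_) (total-suc m) ⟩
    q * total m + (startingAt c m + suc r₀ * total m)  ≡⟨ rearrange q r₀ (total m) (startingAt c m) ⟩
    startingAt c m + (q + r₀) * total m + total m      ∎)
    where
    rearrange : ∀ q r₀ S C → q * S + (C + suc r₀ * S) ≡ C + (q + r₀) * S + S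
    rearrange = solve-∀

  compositions≡colours : ∀ m → Wc m ≡ startingAt c m × Wc̄⁻ m ≡ total m
  compositions≡colours zero    = refl , refl
  compositions≡colours (suc m) with compositions≡colours m
  ... | Wc≡ , Wc̄⁻≡ = Wc-suc≡ , Wc̄⁻-suc≡
    where
    Wc-suc≡ : Wc (suc m) ≡ startingAt c (suc m)
    Wc-suc≡ = begin
      Wc (suc m)                          ≡⟨ Wc-suc m ⟩
      Wc m + (q + r₀) * Wc̄⁻ m             ≡⟨ cong₂ (λ x y → x + (q + r₀) * y) Wc≡ Wc̄⁻≡ ⟩
      startingAt c m + (q + r₀) * total m ≡⟨ startingAt-c-suc m ⟨
      startingAt c (suc m)                ∎
    Wc̄⁻-suc≡ : Wc̄⁻ (suc m) ≡ total (suc m)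
    Wc̄⁻-suc≡ = begin
      Wc̄⁻ (suc m)                        ≡⟨ Wc̄⁻-suc m ⟩
      Wc̄ m + Wc m                         ≡⟨ cong (_+ Wc m) (Wc̄≡b*Wc̄⁻ m) ⟩
      suc r₀ * Wc̄⁻ m + Wc m               ≡⟨ cong₂ (λ x y → suc r₀ * x + y) Wc̄⁻≡ Wc≡ ⟩
      suc r₀ * total m + startingAt c m   ≡⟨ +-comm _ (startingAt c m) ⟩
      startingAt c m + suc r₀ * total m   ≡⟨ total-suc m ⟨
      total (suc m)                       ∎

  total-suc≡Wc+Wc̄ : ∀ m → total (suc m) ≡ Wc m + Wc̄ m
  total-suc≡Wc+Wc̄ m with compositions≡colours m
  ... | Wc≡ , Wc̄⁻≡ = begin
    total (suc m)                     ≡⟨ total-suc m ⟩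
    startingAt c m + suc r₀ * total m ≡⟨ cong₂ (λ x y → x + suc r₀ * y) Wc≡ Wc̄⁻≡ ⟨
    Wc m + suc r₀ * Wc̄⁻ m             ≡⟨ cong (Wc m +_) (Wc̄≡b*Wc̄⁻ m) ⟨
    Wc m + Wc̄ m                       ∎

lemma2 : (r n c d : ℕ) → 2 ≤ r → 1 ≤ n → c < d → d ≤ r ∸ 1 → (q : ℕ) →
    A c d r n q ≡ (n !) * sum (map (λ μ → (q + (r ∸ 2)) ^ t μ * (r ∸ 1) ^ (n ∸ k μ ∸ t μ)) (CompClr n))
lemma2 (suc (suc r₀)) (suc m) c d (s≤s (s≤s _)) (s≤s _) c<d d≤r-1 q = begin
  A c d (2 + r₀) (suc m) q ≡⟨ A≡!*total c<d (2 + r₀) (suc m) q ⟩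
  suc m ! * total (suc m)  ≡⟨ cong (suc m ! *_) (total-suc≡Wc+Wc̄ m) ⟩
  suc m ! * (Wc m + Wc̄ m)  ≡⟨ cong (suc m ! *_) (sum-CompClr _ (suc m)) ⟨
  suc m ! * sum (map (λ μ → (q + r₀) ^ t μ * suc r₀ ^ (suc m ∸ k μ ∸ t μ)) (CompClr (suc m))) ∎
  where
  open ColoursVsCompositions c d r₀ q c<d (s≤s d≤r-1)
  open Colours c d (2 + r₀) q using (total)
  open CompositionWeights (q + r₀) (suc r₀) using (Wc; Wc̄)
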